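{- Let $T$ be a finite decomposition semigroup. Define recursively $T_1=T$ and, for $n\geq 1$: if $T_n$ has a neutral element $e_n$, let $G_n=T_n^{\times}$ be the group of invertible elements of the monoid $T_n$ and set $T_{n+1}=T_n\setminus G_n$; if $T_n$ has no neutral element, stop. Let $D$ be the set of indices $n\geq1$ for which $T_n$ is defined and has a neutral element. Then: (i) either $D=\{1,\dots,N\}$ is finite (for some integer $N\geq 0$), and $T=\big(\bigsqcup_{1\leq n\leq N}G_n\big)\sqcup T_{N+1}$, where $T_{N+1}$ is a finite decomposition semigroup without neutral element; for each $1\leq m\leq N+1$, $T_m=\big(\bigsqcup_{m\leq n\leq N}G_n\big)\sqcup T_{N+1}$ is a sub-semigroup of $T$; and there exists a family of monoid morphisms $\phi_{ij}:G_j\to G_i$ for $1\leq j\leq i\leq N$; (ii) or $D$ is infinite (so $D=\{1,2,3,\dots\}$), and $T=\bigsqcup_{n\geq1}G_n$; for each $m\geq1$, $T_m=\bigsqcup_{n\geq m}G_n$ is a sub-semigroup of $T$; and there exists a family of monoid morphisms $\phi_{ij}:G_j\to G_i$ for $1\leq j\leq i$.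
   Context: A semigroup $T$ is a finite decomposition semigroup if for every $t\in T$ the set of pairs $(t_1,t_2)\in T\times T$ with $t_1t_2=t$ is finite. The empty set is allowed as a semigroup (without neutral element). -}

module Defs where

open import Level using (Level; _⊔_)
open import Algebra.Bundles using (Semigroup)
open import Data.Nat using (ℕ; zero; suc; _≤_)
open import Data.Product using (Σ; ∃; ∃-syntax; _×_; _,_)
open import Data.Sum using (_⊎_)
open import Data.Unit.Polymorphic using (⊤)
open import Data.List using (List)
open import Data.List.Relation.Unary.Any using (Any)
open import Relation.Nullary using (¬_)
open import Relation.Unary using (Pred)
open import Relation.Binary.PropositionalEquality using (_≡_)

module FDS {c ℓ : Level} (S : Semigroup c ℓ) where
  open Semigroup S

  PredT : Set _
  PredT = Pred Carrier (c ⊔ ℓ)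

  FinDecompOn : PredT → Set _
  FinDecompOn P = ∀ t → P t →
    Σ (List (Carrier × Carrier)) λ L →
      ∀ a b → P a → P b → (a ∙ b) ≈ t →
        Any (λ { (a′ , b′) → (a ≈ a′) × (b ≈ b′) }) L

  FiniteDecomposition : Set _
  FiniteDecomposition = ∀ t →
    Σ (List (Carrier × Carrier)) λ L →
      ∀ a b → (a ∙ b) ≈ t →
        Any (λ { (a′ , b′) → (a ≈ a′) × (b ≈ b′) }) L

  SubSemigroup : PredT → Set _
  SubSemigroup P = ∀ x y → P x → P y → P (x ∙ y)

  IsNeutral : PredT → Carrier → Set _
  IsNeutral P e = P e × (∀ x → P x → ((e ∙ x) ≈ x) × ((x ∙ e) ≈ x))

  HasNeutral : PredT → Set _
  HasNeutral P = ∃[ e ] IsNeutral P e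

  Units : PredT → PredT
  Units P x = P x × ∃[ e ] (IsNeutral P e × ∃[ y ] (P y × ((x ∙ y) ≈ e) × ((y ∙ x) ≈ e)))

  -- T_n (paper indexing, n ≥ 1): T_1 = T, T_{n+1} = T_n \ G_n.
  -- (When T_n has no neutral element, Units (T_n) is empty and T_{n+1} = T_n;
  --  these indices are outside D and are never used in the statement.)
  -- T_0 is an unused convention.
  Tn : ℕ → PredT
  Tn zero = λ _ → ⊤
  Tn (suc zero) = λ _ → ⊤
  Tn (suc (suc n)) = λ x → Tn (suc n) x × ¬ Units (Tn (suc n)) x

  Gn : ℕ → PredT
  Gn n = Units (Tn n)

  -- n ∈ D : n ≥ 1, T_n is defined (all T_k, k < n, have neutral elements)
  -- and T_n has a neutral element.
  D : ℕ → Set _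
  D n = (1 ≤ n) × (∀ k → 1 ≤ k → k ≤ n → HasNeutral (Tn k))

  IsDisjointUnion : PredT → (ℕ → Set) → (ℕ → PredT) → PredT → Set _
  IsDisjointUnion P I F R =
      (∀ x → P x → (∃[ n ] (I n × F n x)) ⊎ R x)
    × (∀ x → (∃[ n ] (I n × F n x)) ⊎ R x → P x)
    × (∀ n m x → I n → I m → F n x → F m x → n ≡ m)
    × (∀ n x → I n → F n x → ¬ R x)

  record MonoidMorphism (j i : ℕ) : Set (c ⊔ ℓ) where
    field
      f      : ∀ x → Gn j x → Carrier
      f-into : ∀ x (p : Gn j x) → Gn i (f x p)
      f-cong : ∀ x y (p : Gn j x) (q : Gn j y) → x ≈ y → f x p ≈ f y q
      f-hom  : ∀ x y (p : Gn j x) (q : Gn j y) (r : Gn j (x ∙ y)) →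
               f (x ∙ y) r ≈ (f x p ∙ f y q)
      f-unit : ∀ e (p : Gn j e) → IsNeutral (Tn j) e → IsNeutral (Tn i) (f e p)

-- If e is neutral on a sub-semigroup P and x y = e in P, then xⁿ yⁿ = e for every n, so the
-- finitely many factorisations of e force xᵏ = xˡ for some k < l, whence x^(l-k) = e and x is a
-- unit of P. Hence a non-unit times anything is a non-unit, and T_{n+1} = T_n ∖ G_n is again a
-- sub-semigroup. Each x ∈ T_n either lies in G_n or survives into T_{n+1}; an element surviving
-- forever would satisfy eₙ x = x for the infinitely many, pairwise distinct neutral elements eₙ,
-- contradicting finite decomposition. The morphisms φᵢⱼ can be taken constant with value eᵢ.
module Submission where

open import Defs
open import Level using (_⊔_)
open import Algebra.Bundles using (Semigroup)
open import Axiom.ExcludedMiddle using (ExcludedMiddle)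
open import Data.Nat using (ℕ; zero; suc; _+_; _≤_; _<_; _≤′_; ≤′-refl; ≤′-step; s≤s; z≤n; _≤?_)
open import Data.Nat.Properties
  using (≤⇒≤′; ≤′⇒≤; n<1+n; m<n⇒m<1+n; m≤n⇒∃[o]m+o≡n; <-cmp; ≤-trans; ≤-pred; ≰⇒>;
         m≤m+n; m≤n+m; <⇒≤; m≤n⇒m<n∨m≡n)
open import Data.Fin as Fin using (toℕ)
open import Data.Fin.Properties using (pigeonhole; toℕ<n)
open import Data.List using (List; length; lookup)
open import Data.List.Relation.Unary.Any as Any using (Any; index)
open import Data.List.Relation.Unary.Any.Properties using (lookup-index)
open import Data.Product using (Σ; ∃; ∃-syntax; _×_; _,_; proj₁; proj₂)
open import Data.Sum using (_⊎_; inj₁; inj₂; [_,_])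
open import Data.Empty.Polymorphic using (⊥)
open import Data.Unit.Polymorphic using (⊤; tt)
open import Relation.Nullary using (¬_; yes; no; contradiction)
open import Relation.Nullary.Decidable using (decidable-stable)
open import Relation.Unary using (Decidable)
open import Relation.Binary.Definitions using (tri<; tri≈; tri>)
open import Relation.Binary.PropositionalEquality as ≡ using (_≡_)
open import Function.Bundles using (_⇔_; mk⇔)

Any-pigeonhole : ∀ {a q} {A : Set a} (xs : List A) (Q : ℕ → A → Set q) →
                 (∀ n → n ≤ length xs → Any (Q n) xs) →
                 ∃[ k ] ∃[ l ] k < l × ∃[ z ] Q k z × Q l z
Any-pigeonhole xs Q covered = witness (pigeonhole (n<1+n (length xs)) (λ n → index (covered′ n)))
  where
  covered′ : ∀ n → Any (Q (toℕ n)) xs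
  covered′ n = covered (toℕ n) (≤-pred (toℕ<n n))

  witness : (∃[ i ] ∃[ j ] i Fin.< j × index (covered′ i) ≡ index (covered′ j)) →
            ∃[ k ] ∃[ l ] k < l × ∃[ z ] Q k z × Q l z
  witness (i , j , i<j , same) =
    toℕ i , toℕ j , i<j , lookup xs (index (covered′ i)) , lookup-index (covered′ i) ,
    ≡.subst (λ p → Q (toℕ j) (lookup xs p)) (≡.sym same) (lookup-index (covered′ j))

module _ {p} {P : ℕ → Set p} (P? : Decidable P) where

  all-below-or-least-counterexample :
    ∀ n → (∀ k → k < n → P k) ⊎ ∃[ N ] (∀ k → k < N → P k) × ¬ P N
  all-below-or-least-counterexample zero = inj₁ λ _ ()
  all-below-or-least-counterexample (suc n) with all-below-or-least-counterexample n
  ... | inj₂ least = inj₂ least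
  ... | inj₁ below with P? n
  ...   | no ¬Pn = inj₂ (n , below , ¬Pn)
  ...   | yes Pn = inj₁ λ k k<1+n →
    [ below k , (λ { ≡.refl → Pn }) ] (m≤n⇒m<n∨m≡n (≤-pred k<1+n))

  least-counterexample : ∀ {n} → ¬ P n → ∃[ N ] (∀ k → k < N → P k) × ¬ P N
  least-counterexample {n} ¬Pn with all-below-or-least-counterexample (suc n)
  ... | inj₁ below = contradiction (below n (n<1+n n)) ¬Pn
  ... | inj₂ least = least

all-or-least-counterexample : ∀ {p} {P : ℕ → Set p} → ExcludedMiddle p →
  (∀ n → P n) ⊎ ∃[ N ] (∀ k → k < N → P k) × ¬ P N
all-or-least-counterexample {P = P} em with em {∃ λ n → ¬ P n}
... | yes (_ , ¬Pn) = inj₂ (least-counterexample (λ _ → em) ¬Pn)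
... | no none = inj₁ λ n → decidable-stable em λ ¬Pn → none (n , ¬Pn)

module Decomposition {c ℓ} (S : Semigroup c ℓ) where
  open Semigroup S
  open FDS S
  open import Relation.Binary.Reasoning.Setoid setoid

  -- x ^⁺ n is x^(n+1); a semigroup has no x⁰.
  infixl 8 _^⁺_
  _^⁺_ : Carrier → ℕ → Carrier
  x ^⁺ zero = x
  x ^⁺ suc n = x ^⁺ n ∙ x

  ^⁺-sucˡ : ∀ x n → x ^⁺ suc n ≈ x ∙ x ^⁺ n
  ^⁺-sucˡ x zero = refl
  ^⁺-sucˡ x (suc n) = trans (∙-congʳ (^⁺-sucˡ x n)) (assoc x (x ^⁺ n) x)

  ^⁺-+ : ∀ x m n → x ^⁺ suc (m + n) ≈ x ^⁺ n ∙ x ^⁺ m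
  ^⁺-+ x zero n = refl
  ^⁺-+ x (suc m) n = trans (∙-congʳ (^⁺-+ x m n)) (assoc (x ^⁺ n) (x ^⁺ m) x)

  ^⁺-inverse : ∀ {e x y} → e ∙ y ≈ y → x ∙ y ≈ e → ∀ n → x ^⁺ n ∙ y ^⁺ n ≈ e
  ^⁺-inverse ey≈y xy≈e zero = xy≈e
  ^⁺-inverse {e} {x} {y} ey≈y xy≈e (suc n) = begin
    x ^⁺ suc n ∙ (y ^⁺ n ∙ y)    ≈⟨ ∙-congʳ (^⁺-sucˡ x n) ⟩
    (x ∙ x ^⁺ n) ∙ (y ^⁺ n ∙ y)  ≈⟨ assoc x (x ^⁺ n) (y ^⁺ n ∙ y) ⟩
    x ∙ (x ^⁺ n ∙ (y ^⁺ n ∙ y))  ≈⟨ ∙-congˡ (sym (assoc (x ^⁺ n) (y ^⁺ n) y)) ⟩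
    x ∙ ((x ^⁺ n ∙ y ^⁺ n) ∙ y)  ≈⟨ ∙-congˡ (∙-congʳ (^⁺-inverse ey≈y xy≈e n)) ⟩
    x ∙ (e ∙ y)                  ≈⟨ ∙-congˡ ey≈y ⟩
    x ∙ y                        ≈⟨ xy≈e ⟩
    e                            ∎

  ^⁺-closed : ∀ {P : PredT} → SubSemigroup P → ∀ {x} → P x → ∀ n → P (x ^⁺ n)
  ^⁺-closed closed Px zero = Px
  ^⁺-closed closed {x} Px (suc n) = closed (x ^⁺ n) x (^⁺-closed closed Px n) Px

  ≈-neutral⇒unit : ∀ {P e x} → IsNeutral P e → P x → x ≈ e → Units P x
  ≈-neutral⇒unit {e = e} {x} neutral Px x≈e =
    Px , e , neutral , e , proj₁ neutral , trans (proj₂ (proj₂ neutral x Px)) x≈e ,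
    trans (proj₁ (proj₂ neutral x Px)) x≈e

  module _ {P : PredT} (closed : SubSemigroup P) {e} (neutral : IsNeutral P e) where

    ^⁺-neutral⇒unit : ∀ {x} → P x → ∀ d → x ^⁺ d ≈ e → Units P x
    ^⁺-neutral⇒unit Px zero x≈e = ≈-neutral⇒unit neutral Px x≈e
    ^⁺-neutral⇒unit {x} Px (suc d) x^d+2≈e =
      Px , e , neutral , x ^⁺ d , ^⁺-closed closed Px d ,
      trans (sym (^⁺-sucˡ x d)) x^d+2≈e , x^d+2≈e

    ^⁺-collapse : ∀ {x w} → P x → ∀ k d → x ^⁺ k ∙ w ≈ e → x ^⁺ suc (k + d) ≈ x ^⁺ k →
                  x ^⁺ d ≈ e
    ^⁺-collapse {x} {w} Px k d inverse periodic = begin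
      x ^⁺ d                    ≈⟨ sym (proj₂ (proj₂ neutral (x ^⁺ d) (^⁺-closed closed Px d))) ⟩
      x ^⁺ d ∙ e                ≈⟨ ∙-congˡ (sym inverse) ⟩
      x ^⁺ d ∙ (x ^⁺ k ∙ w)     ≈⟨ sym (assoc (x ^⁺ d) (x ^⁺ k) w) ⟩
      (x ^⁺ d ∙ x ^⁺ k) ∙ w     ≈⟨ ∙-congʳ (sym (^⁺-+ x k d)) ⟩
      x ^⁺ suc (k + d) ∙ w      ≈⟨ ∙-congʳ periodic ⟩
      x ^⁺ k ∙ w                ≈⟨ inverse ⟩
      e                         ∎

    powers-right-invertible⇒unit : FiniteDecomposition → ∀ {x y} → P x →
                                   (∀ n → x ^⁺ n ∙ y ^⁺ n ≈ e) → Units P x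
    powers-right-invertible⇒unit fd {x} {y} Px inverse
      with factorisations , complete ← fd e
      with k , l , k<l , z , xᵏ≈z , xˡ≈z ←
             Any-pigeonhole factorisations (λ n z → x ^⁺ n ≈ proj₁ z)
               (λ n _ → Any.map proj₁ (complete (x ^⁺ n) (y ^⁺ n) (inverse n)))
      with d , ≡.refl ← m≤n⇒∃[o]m+o≡n k<l
      = ^⁺-neutral⇒unit Px d (^⁺-collapse Px k d (inverse k) (trans xˡ≈z (sym xᵏ≈z)))

    right-invertible⇒unit : FiniteDecomposition → ∀ {x y} → P x → P y → x ∙ y ≈ e →
                            Units P x
    right-invertible⇒unit fd Px Py xy≈e =
      powers-right-invertible⇒unit fd Px (^⁺-inverse (proj₁ (proj₂ neutral _ Py)) xy≈e)

  module _ (fd : FiniteDecomposition) where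

    removing-units-preserves-closure : ∀ {P} → SubSemigroup P →
                                       SubSemigroup (λ x → P x × ¬ Units P x)
    removing-units-preserves-closure {P} closed x y (Px , x∉P×) (Py , _) =
      closed x y Px Py , xy∉P×
      where
      xy∉P× : ¬ Units P (x ∙ y)
      xy∉P× (_ , _ , neutral , u , Pu , xyu≈e , _) =
        x∉P× (right-invertible⇒unit closed neutral fd Px (closed y u Py Pu)
               (trans (sym (assoc x y u)) xyu≈e))

    Tn-subsemigroup : ∀ n → SubSemigroup (Tn n)
    Tn-subsemigroup zero _ _ _ _ = tt
    Tn-subsemigroup (suc zero) _ _ _ _ = tt
    Tn-subsemigroup (suc (suc n)) = removing-units-preserves-closure (Tn-subsemigroup (suc n))

    FiniteDecomposition⇒FinDecompOn : ∀ P → FinDecompOn P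
    FiniteDecomposition⇒FinDecompOn P t _ with factorisations , complete ← fd t =
      factorisations , λ a b _ _ ab≈t → complete a b ab≈t

  Tn-suc⊆ : ∀ n {x} → Tn (suc n) x → Tn n x
  Tn-suc⊆ zero _ = tt
  Tn-suc⊆ (suc n) = proj₁

  Tn-antitone : ∀ {m n x} → m ≤ n → Tn n x → Tn m x
  Tn-antitone m≤n = go (≤⇒≤′ m≤n)
    where
    go : ∀ {m n x} → m ≤′ n → Tn n x → Tn m x
    go ≤′-refl t = t
    go {n = suc n} (≤′-step m≤n) t = go m≤n (Tn-suc⊆ n t)

  Tn⇒∉Gn : ∀ {n k x} → 1 ≤ n → n < k → Tn k x → ¬ Gn n x
  Tn⇒∉Gn {suc n} _ n<k t = proj₂ (Tn-antitone n<k t)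

  Gn-disjoint : ∀ {n k x} → 1 ≤ n → 1 ≤ k → Gn n x → Gn k x → n ≡ k
  Gn-disjoint {n} {k} 1≤n 1≤k gn gk with <-cmp n k
  ... | tri< n<k _ _ = contradiction gn (Tn⇒∉Gn 1≤n n<k (proj₁ gk))
  ... | tri≈ _ n≡k _ = n≡k
  ... | tri> _ _ k<n = contradiction gk (Tn⇒∉Gn 1≤k k<n (proj₁ gn))

  constant-morphism : ∀ {j i} → HasNeutral (Tn i) → MonoidMorphism j i
  constant-morphism (e , neutral) = record
    { f      = λ _ _ → e
    ; f-into = λ _ _ → ≈-neutral⇒unit neutral (proj₁ neutral) refl
    ; f-cong = λ _ _ _ _ _ → refl
    ; f-hom  = λ _ _ _ _ _ → sym (proj₁ (proj₂ neutral e (proj₁ neutral)))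
    ; f-unit = λ _ _ _ → neutral
    }

  HasNeutral-upTo : ∀ {N} → (∀ k → k < N → HasNeutral (Tn (suc k))) →
                    ∀ k → 1 ≤ k → k ≤ N → HasNeutral (Tn k)
  HasNeutral-upTo below (suc k) _ k<N = below k k<N

  HasNeutral-≥1 : (∀ n → HasNeutral (Tn (suc n))) → ∀ n → 1 ≤ n → HasNeutral (Tn n)
  HasNeutral-≥1 neutral (suc n) _ = neutral n

  D-finite : ∀ {N} → (∀ k → k < N → HasNeutral (Tn (suc k))) → ¬ HasNeutral (Tn (suc N)) →
             ∀ n → D n ⇔ ((1 ≤ n) × (n ≤ N))
  D-finite {N} below missing n = mk⇔ bounded λ (1≤n , n≤N) →
    1≤n , λ k 1≤k k≤n → HasNeutral-upTo below k 1≤k (≤-trans k≤n n≤N)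
    where
    bounded : D n → (1 ≤ n) × (n ≤ N)
    bounded (1≤n , neutral) with n ≤? N
    ... | yes n≤N = 1≤n , n≤N
    ... | no n≰N = contradiction (neutral (suc N) (s≤s z≤n) (≰⇒> n≰N)) missing

  D-infinite : (∀ n → HasNeutral (Tn (suc n))) → ∀ n → 1 ≤ n → D n
  D-infinite neutral n 1≤n = 1≤n , λ k 1≤k _ → HasNeutral-≥1 neutral k 1≤k

  neutral-throughout-or-first-missing : ExcludedMiddle (c ⊔ ℓ) →
    (∀ n → HasNeutral (Tn (suc n)))
    ⊎ ∃[ N ] (∀ k → k < N → HasNeutral (Tn (suc k))) × ¬ HasNeutral (Tn (suc N))
  neutral-throughout-or-first-missing = all-or-least-counterexample

  module _ (neutral : ∀ n → HasNeutral (Tn (suc n))) where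

    neutral-fixes : ∀ {n b x} → n < b → Tn b x → proj₁ (neutral n) ∙ x ≈ x
    neutral-fixes {n} {x = x} n<b t = proj₁ (proj₂ (proj₂ (neutral n)) x (Tn-antitone n<b t))

    neutrals-distinct : ∀ {k l} → k < l → ¬ proj₁ (neutral k) ≈ proj₁ (neutral l)
    neutrals-distinct {k} {l} k<l eₖ≈eₗ =
      Tn⇒∉Gn (s≤s z≤n) (s≤s k<l) eₗ∈Tₗ₊₁
        (≈-neutral⇒unit (proj₂ (neutral k)) (Tn-antitone (s≤s (<⇒≤ k<l)) eₗ∈Tₗ₊₁) (sym eₖ≈eₗ))
      where
      eₗ∈Tₗ₊₁ : Tn (suc l) (proj₁ (neutral l))
      eₗ∈Tₗ₊₁ = proj₁ (proj₂ (neutral l))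

  module _ (em : ExcludedMiddle (c ⊔ ℓ)) where

    Gn⊎Tn-suc : ∀ n {x} → Tn n x → Gn n x ⊎ Tn (suc n) x
    Gn⊎Tn-suc zero _ = inj₂ tt
    Gn⊎Tn-suc (suc n) {x} t with em {Gn (suc n) x}
    ... | yes g = inj₁ g
    ... | no ¬g = inj₂ (t , ¬g)

    Tn-split : ∀ {a b x} → a ≤ b → Tn a x → (∃[ n ] ((a ≤ n × n < b) × Gn n x)) ⊎ Tn b x
    Tn-split a≤b = go (≤⇒≤′ a≤b)
      where
      go : ∀ {a b x} → a ≤′ b → Tn a x → (∃[ n ] ((a ≤ n × n < b) × Gn n x)) ⊎ Tn b x
      go ≤′-refl t = inj₂ t
      go {b = suc b} (≤′-step a≤b) t with go a≤b t
      ... | inj₁ (n , (a≤n , n<b) , g) = inj₁ (n , (a≤n , m<n⇒m<1+n n<b) , g)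
      ... | inj₂ t′ with Gn⊎Tn-suc b t′
      ...   | inj₁ g = inj₁ (b , (≤′⇒≤ a≤b , n<1+n b) , g)
      ...   | inj₂ t″ = inj₂ t″

    Tn-disjoint-union : ∀ {m N} → 1 ≤ m → m ≤ suc N →
      IsDisjointUnion (Tn m) (λ n → (m ≤ n) × (n ≤ N)) Gn (Tn (suc N))
    Tn-disjoint-union {m} {N} 1≤m m≤N+1 = cover , contained , disjoint , separate
      where
      cover : ∀ x → Tn m x → (∃[ n ] ((m ≤ n × n ≤ N) × Gn n x)) ⊎ Tn (suc N) x
      cover x t with Tn-split m≤N+1 t
      ... | inj₁ (n , (m≤n , n<N+1) , g) = inj₁ (n , (m≤n , ≤-pred n<N+1) , g)
      ... | inj₂ t′ = inj₂ t′
      contained : ∀ x → (∃[ n ] ((m ≤ n × n ≤ N) × Gn n x)) ⊎ Tn (suc N) x → Tn m x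
      contained x (inj₁ (n , (m≤n , _) , g)) = Tn-antitone m≤n (proj₁ g)
      contained x (inj₂ t) = Tn-antitone m≤N+1 t
      disjoint : ∀ n k x → m ≤ n × n ≤ N → m ≤ k × k ≤ N → Gn n x → Gn k x → n ≡ k
      disjoint n k x (m≤n , _) (m≤k , _) = Gn-disjoint (≤-trans 1≤m m≤n) (≤-trans 1≤m m≤k)
      separate : ∀ n x → m ≤ n × n ≤ N → Gn n x → ¬ Tn (suc N) x
      separate n x (m≤n , n≤N) g t = Tn⇒∉Gn (≤-trans 1≤m m≤n) (s≤s n≤N) t g

    module _ (fd : FiniteDecomposition) (neutral : ∀ n → HasNeutral (Tn (suc n))) where

      eventually-unit : ∀ {m x} → Tn m x → ∃[ n ] (m ≤ n × Gn n x)
      eventually-unit {m} {x} t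
        with factorisations , complete ← fd x
        with Tn-split (m≤n+m m (suc (length factorisations))) t
      ... | inj₁ (n , (m≤n , _) , g) = n , m≤n , g
      ... | inj₂ t′
        with k , l , k<l , _ , eₖ≈z , eₗ≈z ←
               Any-pigeonhole factorisations (λ n z → proj₁ (neutral n) ≈ proj₁ z)
                 (λ n n≤len → Any.map proj₁ (complete _ x
                    (neutral-fixes neutral (s≤s (≤-trans n≤len (m≤m+n _ m))) t′)))
        = contradiction (trans eₖ≈z (sym eₗ≈z)) (neutrals-distinct neutral k<l)

      Tn-disjoint-union-∞ : ∀ {m} → 1 ≤ m → IsDisjointUnion (Tn m) (m ≤_) Gn (λ _ → ⊥)
      Tn-disjoint-union-∞ {m} 1≤m = cover , contained , disjoint , λ _ _ _ _ ()
        where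
        cover : ∀ x → Tn m x → (∃[ n ] (m ≤ n × Gn n x)) ⊎ ⊥
        cover x t = inj₁ (eventually-unit t)
        contained : ∀ x → (∃[ n ] (m ≤ n × Gn n x)) ⊎ ⊥ → Tn m x
        contained x (inj₁ (n , m≤n , g)) = Tn-antitone m≤n (proj₁ g)
        disjoint : ∀ n k x → m ≤ n → m ≤ k → Gn n x → Gn k x → n ≡ k
        disjoint n k x m≤n m≤k = Gn-disjoint (≤-trans 1≤m m≤n) (≤-trans 1≤m m≤k)

mainTheorem2 : ∀ {c ℓ} (S : Semigroup c ℓ) → ExcludedMiddle (c ⊔ ℓ) →
    let open FDS S in
    FiniteDecomposition →
    (Σ ℕ λ N →
        (∀ n → D n ⇔ ((1 ≤ n) × (n ≤ N)))
      × IsDisjointUnion (λ _ → ⊤) (λ n → (1 ≤ n) × (n ≤ N)) Gn (Tn (suc N))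
      × (SubSemigroup (Tn (suc N)) × FinDecompOn (Tn (suc N)) × ¬ HasNeutral (Tn (suc N)))
      × (∀ m → 1 ≤ m → m ≤ suc N →
           IsDisjointUnion (Tn m) (λ n → (m ≤ n) × (n ≤ N)) Gn (Tn (suc N))
         × SubSemigroup (Tn m))
      × (∀ i j → 1 ≤ j → j ≤ i → i ≤ N → MonoidMorphism j i))
    ⊎
    ((∀ n → 1 ≤ n → D n)
      × IsDisjointUnion (λ _ → ⊤) (λ n → 1 ≤ n) Gn (λ _ → ⊥)
      × (∀ m → 1 ≤ m →
           IsDisjointUnion (Tn m) (λ n → m ≤ n) Gn (λ _ → ⊥)
         × SubSemigroup (Tn m))
      × (∀ i j → 1 ≤ j → j ≤ i → MonoidMorphism j i))
mainTheorem2 S em fd with Decomposition.neutral-throughout-or-first-missing S em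
... | inj₂ (N , below , missing) = let open Decomposition S in
  inj₁ (N , D-finite below missing ,
        Tn-disjoint-union em (s≤s z≤n) (s≤s z≤n) ,
        (Tn-subsemigroup fd (suc N) , FiniteDecomposition⇒FinDecompOn fd _ , missing) ,
        (λ m 1≤m m≤N+1 → Tn-disjoint-union em 1≤m m≤N+1 , Tn-subsemigroup fd m) ,
        λ i j 1≤j j≤i i≤N → constant-morphism (HasNeutral-upTo below i (≤-trans 1≤j j≤i) i≤N))
... | inj₁ neutral = let open Decomposition S in
  inj₂ (D-infinite neutral ,
        Tn-disjoint-union-∞ em fd neutral (s≤s z≤n) ,
        (λ m 1≤m → Tn-disjoint-union-∞ em fd neutral 1≤m , Tn-subsemigroup fd m) ,
        λ i j 1≤j j≤i → constant-morphism (HasNeutral-≥1 neutral i (≤-trans 1≤j j≤i)))
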